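{- Let $\mathcal{H}$ be a hypergraph with $\varepsilon$ edges and maximum degree $\Delta\ge1$, and let $r=a\Delta+b$ for non-negative integers $a,b$ with $b\in[\Delta]$. Then \[ a\varepsilon+ms_b(\mathcal{H})\le ms_r(\mathcal{H})\quad\text{and}\quad a\varepsilon+cms_b(\mathcal{H})\le cms_r(\mathcal{H}). \]
   Context: A hypergraph $\mathcal{H}=(V,E)$ consists of a finite vertex set $V$ and a finite set $E$ of edges, each with an associated vertex set; parallel edges are allowed. $[n]=\{0,1,\ldots,n-1\}$. An ordering of $\mathcal{H}$ is a bijection $\ell:E\to[\varepsilon]$, $\varepsilon=|E|$. For a sequence $S=e_0,\ldots,e_{s-1}$ of (not necessarily distinct) edges, $\mathcal{H}(S)$ is the hypergraph whose edges are the $s$ terms of $S$ counted with multiplicity (so the degree of $v$ is $|\{i:v\in e_i\}|$). $S$ is cyclically consecutive in $\ell$ if $\ell(e_i)\equiv\ell(e_0)+i\pmod{\varepsilon}$ for all $i$; if $a'$ is the integer with $a'\varepsilon\le s<(a'+1)\varepsilon$, $S$ is consecutive in $\ell$ if it is cyclically consecutive and $\ell(e_0)\le(a'+1)\varepsilon-s$. $ms_r(\ell)$ (resp. $cms_r(\ell)$) is the largest $s$ such that every sequence $S$ of $s$ consecutive (resp. cyclically consecutive) edges of $\ell$ satisfies $\Delta(\mathcal{H}(S))\le r$; $ms_r(\mathcal{H})$, $cms_r(\mathcal{H})$ are the maxima over all orderings $\ell$. -}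

module Defs where

open import Data.Nat using (ℕ; zero; suc; _+_; _*_; _∸_; _≤_; _<_)
open import Data.Fin using (Fin; zero; suc; toℕ)
open import Data.Fin.Subset using (Subset)
open import Data.Fin.Permutation using (Permutation′; _⟨$⟩ʳ_)
open import Data.Vec using (lookup)
open import Data.Bool using (Bool; true; false; if_then_else_)
open import Data.Product using (Σ; ∃; _×_)
open import Relation.Binary.PropositionalEquality using (_≡_)

-- A hypergraph with vertex set V = Fin n and edge set E = Fin ε;
-- each edge e has vertex set H e (parallel edges allowed).
Hypergraph : ℕ → ℕ → Set
Hypergraph n ε = Fin ε → Subset n

count : ∀ {s} → (Fin s → Bool) → ℕ
count {zero} f = 0
count {suc s} f = (if f zero then 1 else 0) + count {s} (λ i → f (suc i))

-- degree of vertex v in the hypergraph H(S) of a sequence S = e_0 … e_{s-1}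
-- of edges of H (edges counted with multiplicity)
degSeq : ∀ {n ε s} → Hypergraph n ε → (Fin s → Fin ε) → Fin n → ℕ
degSeq H S v = count (λ i → lookup (H (S i)) v)

deg : ∀ {n ε} → Hypergraph n ε → Fin n → ℕ
deg {ε = ε} H v = degSeq {s = ε} H (λ e → e) v

IsMaxDegree : ∀ {n ε} → Hypergraph n ε → ℕ → Set
IsMaxDegree H Δ = (∀ v → deg H v ≤ Δ) × ∃ λ v → deg H v ≡ Δ

MaxDeg≤ : ∀ {n ε s} → Hypergraph n ε → (Fin s → Fin ε) → ℕ → Set
MaxDeg≤ H S r = ∀ v → degSeq H S v ≤ r

Ordering : ℕ → Set
Ordering ε = Permutation′ ε

-- x ≡ y (mod ε), for naturals with y < ε written as  x = k ε + y
_≡_[mod_] : ℕ → ℕ → ℕ → Set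
x ≡ y [mod ε ] = ∃ λ k → x ≡ k * ε + y

-- S is cyclically consecutive in ℓ, with ℓ(e_0) = p :
-- ℓ(e_i) ≡ p + i (mod ε) for all i.  (For s ≥ 1, p is forced to be ℓ(e_0).)
CycConsFrom : ∀ {ε s} → Ordering ε → Fin ε → (Fin s → Fin ε) → Set
CycConsFrom {ε} ℓ p S = ∀ i → (toℕ p + toℕ i) ≡ toℕ (ℓ ⟨$⟩ʳ S i) [mod ε ]

CyclicallyConsecutive : ∀ {ε s} → Ordering ε → (Fin s → Fin ε) → Set
CyclicallyConsecutive {ε} ℓ S = ∃ λ (p : Fin ε) → CycConsFrom ℓ p S

Consecutive : ∀ {ε s} → Ordering ε → (Fin s → Fin ε) → Set
Consecutive {ε} {s} ℓ S = ∃ λ (p : Fin ε) → CycConsFrom ℓ p S ×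
  (∀ a′ → a′ * ε ≤ s → s < suc a′ * ε → toℕ p ≤ suc a′ * ε ∸ s)

GoodMS : ∀ {n ε} → Hypergraph n ε → Ordering ε → ℕ → ℕ → Set
GoodMS H ℓ r s = (S : Fin s → Fin _) → Consecutive ℓ S → MaxDeg≤ H S r

GoodCMS : ∀ {n ε} → Hypergraph n ε → Ordering ε → ℕ → ℕ → Set
GoodCMS H ℓ r s = (S : Fin s → Fin _) → CyclicallyConsecutive ℓ S → MaxDeg≤ H S r

IsLargest : (ℕ → Set) → ℕ → Set
IsLargest P m = P m × (∀ s → P s → s ≤ m)

IsMSℓ : ∀ {n ε} → Hypergraph n ε → Ordering ε → ℕ → ℕ → Set
IsMSℓ H ℓ r = IsLargest (GoodMS H ℓ r)

IsCMSℓ : ∀ {n ε} → Hypergraph n ε → Ordering ε → ℕ → ℕ → Set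
IsCMSℓ H ℓ r = IsLargest (GoodCMS H ℓ r)

IsMS : ∀ {n ε} → Hypergraph n ε → ℕ → ℕ → Set
IsMS {ε = ε} H r = IsLargest (λ m → ∃ λ (ℓ : Ordering ε) → IsMSℓ H ℓ r m)

IsCMS : ∀ {n ε} → Hypergraph n ε → ℕ → ℕ → Set
IsCMS {ε = ε} H r = IsLargest (λ m → ∃ λ (ℓ : Ordering ε) → IsCMSℓ H ℓ r m)

-- Let S be a cyclically consecutive sequence of aε + s edges of an ordering ℓ.
-- Its first aε terms split into a blocks of ε consecutive positions; within a
-- block the positions ℓ(e_i) form a complete residue system mod ε, so the block
-- lists every edge exactly once and contributes deg v ≤ Δ to the degree of v.
-- The last s terms are again (cyclically) consecutive.  Hence if all windows of
-- length s have maximum degree at most b, all windows of length aε + s have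
-- maximum degree at most aΔ + b = r.  As Δ ≥ 1, no window of length (r+1)ε is
-- good for r, so ms_r(ℓ) and cms_r(ℓ) exist; constructively only up to double
-- negation, which suffices because the inequality to be proved is decidable.
module Submission where

open import Data.Bool using (Bool; true; false; not; if_then_else_)
open import Data.Fin using (Fin; zero; suc; toℕ; _↑ˡ_; _↑ʳ_; punchIn; punchOut)
open import Data.Fin.Properties
  using (suc-injective; toℕ-injective; toℕ-↑ˡ; toℕ-↑ʳ; toℕ<n; toℕ-fromℕ<;
         punchOut-injective; punchIn-punchOut)
open import Data.Fin.Permutation using (_⟨$⟩ʳ_; _⟨$⟩ˡ_; inverseʳ)
open import Data.Nat using (ℕ; zero; suc; _+_; _*_; _∸_; _≤_; _<_; _≤?_; z≤n; NonZero)
open import Data.Nat.DivMod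
  using (_%_; _/_; _mod_; m≡m%n+[m/n]*n; [m+kn]%n≡m%n; m<n⇒m%n≡m)
open import Data.Nat.Divisibility using (_∣_; divides; >⇒∤)
open import Data.Nat.Properties hiding (suc-injective)
open import Algebra.Properties.CommutativeSemigroup +-commutativeSemigroup
  using (x∙yz≈y∙xz; xy∙z≈xz∙y)
open import Data.Product using (_×_; _,_; ∃)
open import Data.Sum using ([_,_]′)
open import Data.Vec using (lookup)
open import Function using (_∘_)
open import Function.Definitions using (Injective)
open import Relation.Nullary using (¬_; contradiction)
open import Relation.Nullary.Decidable using (decidable-stable)
open import Relation.Binary.PropositionalEquality
  using (_≡_; _≢_; refl; sym; trans; cong; cong₂; subst; module ≡-Reasoning)

open import Defs

indicator : Bool → ℕ
indicator b = if b then 1 else 0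

count-cong : ∀ {s} {f g : Fin s → Bool} → (∀ i → f i ≡ g i) → count f ≡ count g
count-cong {zero}  f≗g = refl
count-cong {suc s} f≗g =
  cong₂ _+_ (cong indicator (f≗g zero)) (count-cong (f≗g ∘ suc))

count-++ : ∀ m {k} (f : Fin (m + k) → Bool) →
  count f ≡ count (f ∘ (_↑ˡ k)) + count (f ∘ (m ↑ʳ_))
count-++ zero    f = refl
count-++ (suc m) f =
  trans (cong (indicator (f zero) +_) (count-++ m (f ∘ suc)))
    (sym (+-assoc (indicator (f zero)) _ _))

count-punchIn : ∀ {n} (f : Fin (suc n) → Bool) k →
  count f ≡ indicator (f k) + count (f ∘ punchIn k)
count-punchIn f zero = refl
count-punchIn {suc n} f (suc k) =
  trans (cong (indicator (f zero) +_) (count-punchIn (f ∘ suc) k))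
    (x∙yz≈y∙xz (indicator (f zero)) (indicator (f (suc k))) _)

count+count-not : ∀ {s} (f : Fin s → Bool) → count f + count (not ∘ f) ≡ s
count+count-not {zero}  f = refl
count+count-not {suc s} f with f zero
... | true  = cong suc (count+count-not (f ∘ suc))
... | false = trans (+-suc _ _) (cong suc (count+count-not (f ∘ suc)))

count-∘-injective-≤ : ∀ {m n} (f : Fin n → Bool) {σ : Fin m → Fin n} →
  Injective _≡_ _≡_ σ → count (f ∘ σ) ≤ count f
count-∘-injective-≤ {zero} f _ = z≤n
count-∘-injective-≤ {suc m} {zero} f {σ} _ with σ zero
... | ()
count-∘-injective-≤ {suc m} {suc n} f {σ} σ-inj = begin
  count (f ∘ σ)                    ≡⟨ cong (b +_) (count-cong f∘σₛ≗g∘τ) ⟩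
  b + count (g ∘ τ)                ≤⟨ +-monoʳ-≤ b (count-∘-injective-≤ g τ-inj) ⟩
  b + count g                      ≡⟨ count-punchIn f (σ zero) ⟨
  count f                          ∎
  where
  open ≤-Reasoning
  b : ℕ
  b = indicator (f (σ zero))
  g : Fin n → Bool
  g = f ∘ punchIn (σ zero)
  σ₀≢σₛ : ∀ i → σ zero ≢ σ (suc i)
  σ₀≢σₛ i eq with σ-inj eq
  ... | ()
  τ : Fin m → Fin n
  τ i = punchOut (σ₀≢σₛ i)
  τ-inj : Injective _≡_ _≡_ τ
  τ-inj eq = suc-injective (σ-inj (punchOut-injective (σ₀≢σₛ _) (σ₀≢σₛ _) eq))
  f∘σₛ≗g∘τ : ∀ i → f (σ (suc i)) ≡ g (τ i)
  f∘σₛ≗g∘τ = cong f ∘ sym ∘ punchIn-punchOut ∘ σ₀≢σₛ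

-- The bounds for f and for not ∘ f add up to the same total n, so both are tight.
count-∘-injective : ∀ {n} (f : Fin n → Bool) {σ : Fin n → Fin n} →
  Injective _≡_ _≡_ σ → count (f ∘ σ) ≡ count f
count-∘-injective {n} f {σ} σ-inj = ≤-antisym (count-∘-injective-≤ f σ-inj) f≤fσ
  where
  open ≤-Reasoning
  f≤fσ : count f ≤ count (f ∘ σ)
  f≤fσ = +-cancelʳ-≤ (count (not ∘ f)) _ _ (begin
    count f + count (not ∘ f)            ≡⟨ count+count-not f ⟩
    n                                    ≡⟨ count+count-not (f ∘ σ) ⟨
    count (f ∘ σ) + count (not ∘ f ∘ σ)  ≤⟨ +-monoʳ-≤ _ (count-∘-injective-≤ (not ∘ f) σ-inj) ⟩
    count (f ∘ σ) + count (not ∘ f)      ∎)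

[mod]-congˡ : ∀ {ε x x′ y} → x ≡ x′ → x ≡ y [mod ε ] → x′ ≡ y [mod ε ]
[mod]-congˡ refl x≡y = x≡y

%≡⇒[mod] : ∀ {ε x y} .{{_ : NonZero ε}} → x % ε ≡ y → x ≡ y [mod ε ]
%≡⇒[mod] {ε} {x} refl = x / ε , trans (m≡m%n+[m/n]*n x ε) (+-comm (x % ε) _)

[mod]⇒%≡ : ∀ {ε x y} .{{_ : NonZero ε}} → y < ε → x ≡ y [mod ε ] → x % ε ≡ y
[mod]⇒%≡ {ε} {y = y} y<ε (k , refl) =
  trans (cong (_% ε) (+-comm (k * ε) y)) (trans ([m+kn]%n≡m%n y k ε) (m<n⇒m%n≡m y<ε))

[mod]-offset-∣ : ∀ {ε x y d} → x ≡ y [mod ε ] → (x + d) ≡ y [mod ε ] → ε ∣ d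
[mod]-offset-∣ {ε} {x} {y} {d} (k , x≡) (k′ , x+d≡) = divides (k′ ∸ k) (begin
  d                  ≡⟨ m+n∸m≡n (k * ε) d ⟨
  k * ε + d ∸ k * ε  ≡⟨ cong (_∸ k * ε) kε+d≡k′ε ⟩
  k′ * ε ∸ k * ε     ≡⟨ *-distribʳ-∸ ε k′ k ⟨
  (k′ ∸ k) * ε       ∎)
  where
  open ≡-Reasoning
  kε+d≡k′ε : k * ε + d ≡ k′ * ε
  kε+d≡k′ε = +-cancelʳ-≡ y _ _ (begin
    k * ε + d + y  ≡⟨ xy∙z≈xz∙y (k * ε) d y ⟩
    k * ε + y + d  ≡⟨ cong (_+ d) x≡ ⟨
    x + d          ≡⟨ x+d≡ ⟩
    k′ * ε + y     ∎)

∣∧<⇒≡0 : ∀ {ε d} → ε ∣ d → d < ε → d ≡ 0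
∣∧<⇒≡0 {d = zero}  _   _   = refl
∣∧<⇒≡0 {d = suc _} ε∣d d<ε = contradiction ε∣d (>⇒∤ d<ε)

+-[mod]-cancelˡ : ∀ {ε q i j y} → (q + i) ≡ y [mod ε ] → (q + j) ≡ y [mod ε ] →
  i < ε → j < ε → i ≡ j
+-[mod]-cancelˡ {ε} {q} {i} {j} {y} qi qj i<ε j<ε =
  [ (λ i≤j → ordered i≤j qi qj j<ε) , (λ j≤i → sym (ordered j≤i qj qi i<ε)) ]′
    (≤-total i j)
  where
  ordered : ∀ {i j} → i ≤ j →
    (q + i) ≡ y [mod ε ] → (q + j) ≡ y [mod ε ] → j < ε → i ≡ j
  ordered {i} i≤j qi qj j<ε with m≤n⇒∃[o]m+o≡n i≤j
  ... | d , refl = sym (trans (cong (i +_) d≡0) (+-identityʳ i))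
    where
    d≡0 : d ≡ 0
    d≡0 = ∣∧<⇒≡0 ([mod]-offset-∣ qi ([mod]-congˡ (sym (+-assoc q i d)) qj))
                 (≤-<-trans (m≤n+m d i) j<ε)

-- CycConsFrom with the starting position in ℕ, so that it can be shifted past ε.
CycConsFromℕ : ∀ {ε s} → Ordering ε → ℕ → (Fin s → Fin ε) → Set
CycConsFromℕ {ε} ℓ q S = ∀ i → (q + toℕ i) ≡ toℕ (ℓ ⟨$⟩ʳ S i) [mod ε ]

module _ {ε} (ℓ : Ordering ε) where

  cycConsFrom-↑ˡ : ∀ {m k q} {S : Fin (m + k) → Fin ε} →
    CycConsFromℕ ℓ q S → CycConsFromℕ ℓ q (S ∘ (_↑ˡ k))
  cycConsFrom-↑ˡ {k = k} {q} cc i = [mod]-congˡ (cong (q +_) (toℕ-↑ˡ i k)) (cc (i ↑ˡ k))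

  cycConsFrom-↑ʳ : ∀ {m k q} {S : Fin (m + k) → Fin ε} →
    CycConsFromℕ ℓ q S → CycConsFromℕ ℓ (q + m) (S ∘ (m ↑ʳ_))
  cycConsFrom-↑ʳ {m} {q = q} cc i =
    [mod]-congˡ (trans (cong (q +_) (toℕ-↑ʳ m i)) (sym (+-assoc q m (toℕ i)))) (cc (m ↑ʳ i))

  cycConsFrom-+rounds : ∀ .{{_ : NonZero ε}} {s q a} {S : Fin s → Fin ε} →
    CycConsFromℕ ℓ (q + a * ε) S → CycConsFromℕ ℓ q S
  cycConsFrom-+rounds {q = q} {a} {S} cc i = %≡⇒[mod] (begin
    (q + toℕ i) % ε          ≡⟨ [m+kn]%n≡m%n (q + toℕ i) a ε ⟨
    (q + toℕ i + a * ε) % ε  ≡⟨ cong (_% ε) (xy∙z≈xz∙y q (toℕ i) (a * ε)) ⟩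
    (q + a * ε + toℕ i) % ε  ≡⟨ [mod]⇒%≡ (toℕ<n _) (cc i) ⟩
    toℕ (ℓ ⟨$⟩ʳ S i)         ∎)
    where open ≡-Reasoning

  cycConsFrom-injective : ∀ {q} {S : Fin ε → Fin ε} →
    CycConsFromℕ ℓ q S → Injective _≡_ _≡_ S
  cycConsFrom-injective {q} cc {i} {j} Si≡Sj =
    toℕ-injective (+-[mod]-cancelˡ (cc i) qj (toℕ<n i) (toℕ<n j))
    where
    qj : (q + toℕ j) ≡ toℕ (ℓ ⟨$⟩ʳ _) [mod ε ]
    qj = subst (λ e → (q + toℕ j) ≡ toℕ (ℓ ⟨$⟩ʳ e) [mod ε ]) (sym Si≡Sj) (cc j)

degSeq-rounds : ∀ {n ε} (H : Hypergraph n ε) {ℓ : Ordering ε} a {q}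
  {S : Fin (a * ε) → Fin ε} → CycConsFromℕ ℓ q S → ∀ v → degSeq H S v ≡ a * deg H v
degSeq-rounds H zero    _ _ = refl
degSeq-rounds {ε = ε} H {ℓ} (suc a) {S = S} cc v = begin
  degSeq H S v                     ≡⟨ count-++ ε _ ⟩
  degSeq H (S ∘ (_↑ˡ (a * ε))) v + degSeq H (S ∘ (ε ↑ʳ_)) v
                                   ≡⟨ cong₂ _+_ first-round later-rounds ⟩
  deg H v + a * deg H v            ∎
  where
  open ≡-Reasoning
  first-round : degSeq H (S ∘ (_↑ˡ (a * ε))) v ≡ deg H v
  first-round = count-∘-injective (λ e → lookup (H e) v)
                  (cycConsFrom-injective ℓ (cycConsFrom-↑ˡ ℓ cc))
  later-rounds : degSeq H (S ∘ (ε ↑ʳ_)) v ≡ a * deg H v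
  later-rounds = degSeq-rounds H {ℓ} a (cycConsFrom-↑ʳ ℓ cc) v

wrap : ∀ {e} → Ordering (suc e) → ∀ s → Fin s → Fin (suc e)
wrap {e} ℓ s i = ℓ ⟨$⟩ˡ (toℕ i mod suc e)

wrap-cycConsFrom : ∀ {e} (ℓ : Ordering (suc e)) s → CycConsFrom ℓ zero (wrap ℓ s)
wrap-cycConsFrom {e} ℓ s i = %≡⇒[mod] (begin
  toℕ i % suc e                            ≡⟨ toℕ-fromℕ< _ ⟨
  toℕ (toℕ i mod suc e)                    ≡⟨ cong toℕ (inverseʳ ℓ) ⟨
  toℕ (ℓ ⟨$⟩ʳ (ℓ ⟨$⟩ˡ (toℕ i mod suc e)))  ∎)
  where open ≡-Reasoning

wrap-consecutive : ∀ {e} (ℓ : Ordering (suc e)) s → Consecutive ℓ (wrap ℓ s)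
wrap-consecutive ℓ s = zero , wrap-cycConsFrom ℓ s , λ _ _ _ → z≤n

module _ {n e} (H : Hypergraph n (suc e)) (ℓ : Ordering (suc e)) {r : ℕ} {v : Fin n}
         (1≤deg : 1 ≤ deg H v) where

  r<degSeq-wrap : ∀ t → r < degSeq H (wrap ℓ (suc r * suc e + t)) v
  r<degSeq-wrap t = begin-strict
    r                         <⟨ n<1+n r ⟩
    suc r                     ≡⟨ *-identityʳ (suc r) ⟨
    suc r * 1                 ≤⟨ *-monoʳ-≤ (suc r) 1≤deg ⟩
    suc r * deg H v           ≡⟨ prefix-rounds ⟨
    degSeq H (S ∘ (_↑ˡ t)) v  ≤⟨ m≤m+n _ _ ⟩
    degSeq H (S ∘ (_↑ˡ t)) v + degSeq H (S ∘ (suc r * suc e ↑ʳ_)) v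
                              ≡⟨ count-++ (suc r * suc e) (λ i → lookup (H (S i)) v) ⟨
    degSeq H S v              ∎
    where
    open ≤-Reasoning
    S : Fin (suc r * suc e + t) → Fin (suc e)
    S = wrap ℓ (suc r * suc e + t)
    prefix-rounds : degSeq H (S ∘ (_↑ˡ t)) v ≡ suc r * deg H v
    prefix-rounds = degSeq-rounds H {ℓ} (suc r) (cycConsFrom-↑ˡ ℓ {S = S} (wrap-cycConsFrom ℓ _)) v

  maxDeg≤-wrap⇒≤ : ∀ s → MaxDeg≤ H (wrap ℓ s) r → s ≤ suc r * suc e
  maxDeg≤-wrap⇒≤ s bounded = ≮⇒≥ λ long → unbounded (m≤n⇒∃[o]m+o≡n (<⇒≤ long)) bounded
    where
    unbounded : ∀ {s} → ∃ (λ t → suc r * suc e + t ≡ s) → ¬ MaxDeg≤ H (wrap ℓ s) r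
    unbounded (t , refl) bounded = <⇒≱ (r<degSeq-wrap t) (bounded v)

  goodMS⇒≤ : ∀ s → GoodMS H ℓ r s → s ≤ suc r * suc e
  goodMS⇒≤ s good = maxDeg≤-wrap⇒≤ s (good (wrap ℓ s) (wrap-consecutive ℓ s))

  goodCMS⇒≤ : ∀ s → GoodCMS H ℓ r s → s ≤ suc r * suc e
  goodCMS⇒≤ s good = maxDeg≤-wrap⇒≤ s (good (wrap ℓ s) (zero , wrap-cycConsFrom ℓ s))

ConsecutiveStart : ℕ → ℕ → ℕ → Set
ConsecutiveStart ε s p = ∀ a′ → a′ * ε ≤ s → s < suc a′ * ε → p ≤ suc a′ * ε ∸ s

consecutiveStart-+rounds : ∀ {ε s p} a →
  ConsecutiveStart ε (a * ε + s) p → ConsecutiveStart ε s p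
consecutiveStart-+rounds {ε} {s} {p} a start a′ lo hi =
  subst (p ≤_) shift (start (a + a′) lo′ hi′)
  where
  next-round : suc (a + a′) * ε ≡ a * ε + suc a′ * ε
  next-round = trans (cong (_* ε) (sym (+-suc a a′))) (*-distribʳ-+ ε a (suc a′))
  lo′ : (a + a′) * ε ≤ a * ε + s
  lo′ = subst (_≤ a * ε + s) (sym (*-distribʳ-+ ε a a′)) (+-monoʳ-≤ (a * ε) lo)
  hi′ : a * ε + s < suc (a + a′) * ε
  hi′ = subst (a * ε + s <_) (sym next-round) (+-monoʳ-< (a * ε) hi)
  shift : suc (a + a′) * ε ∸ (a * ε + s) ≡ suc a′ * ε ∸ s
  shift = trans (cong (_∸ (a * ε + s)) next-round) ([m+n]∸[m+o]≡n∸o (a * ε) (suc a′ * ε) s)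

module _ {n ε} .{{_ : NonZero ε}} (H : Hypergraph n ε) {Δ} (deg≤Δ : ∀ v → deg H v ≤ Δ)
         (ℓ : Ordering ε) (a : ℕ) {b mb : ℕ} where

  maxDeg≤-rounds+ : ∀ {q} {S : Fin (a * ε + mb) → Fin ε} → CycConsFromℕ ℓ q S →
    MaxDeg≤ H (S ∘ (a * ε ↑ʳ_)) b → MaxDeg≤ H S (a * Δ + b)
  maxDeg≤-rounds+ {S = S} cc tail≤b v = begin
    degSeq H S v                                    ≡⟨ count-++ (a * ε) (λ i → lookup (H (S i)) v) ⟩
    degSeq H (S ∘ (_↑ˡ mb)) v + degSeq H tail v     ≡⟨ cong (_+ degSeq H tail v) rounds ⟩
    a * deg H v + degSeq H tail v                   ≤⟨ +-mono-≤ (*-monoʳ-≤ a (deg≤Δ v)) (tail≤b v) ⟩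
    a * Δ + b                                       ∎
    where
    open ≤-Reasoning
    tail : Fin mb → Fin ε
    tail = S ∘ (a * ε ↑ʳ_)
    rounds : degSeq H (S ∘ (_↑ˡ mb)) v ≡ a * deg H v
    rounds = degSeq-rounds H {ℓ} a (cycConsFrom-↑ˡ ℓ cc) v

  tail-cycConsFrom : ∀ {q} {S : Fin (a * ε + mb) → Fin ε} → CycConsFromℕ ℓ q S →
    CycConsFromℕ ℓ q (S ∘ (a * ε ↑ʳ_))
  tail-cycConsFrom cc = cycConsFrom-+rounds ℓ {a = a} (cycConsFrom-↑ʳ ℓ cc)

  goodCMS-+rounds : GoodCMS H ℓ b mb → GoodCMS H ℓ (a * Δ + b) (a * ε + mb)
  goodCMS-+rounds good S (p , cc) = maxDeg≤-rounds+ cc (good _ (p , tail-cycConsFrom cc))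

  goodMS-+rounds : GoodMS H ℓ b mb → GoodMS H ℓ (a * Δ + b) (a * ε + mb)
  goodMS-+rounds good S (p , cc , start) =
    maxDeg≤-rounds+ cc (good _ (p , tail-cycConsFrom cc , consecutiveStart-+rounds a start))

-- Classically P has a largest element; constructively we may only refute that
-- none exists.  The fuel k bounds how far above t the search can go.
largest-within : (P : ℕ → Set) {B : ℕ} → (∀ s → P s → s ≤ B) →
  ∀ k {t} → B ≤ t + k → P t → ¬ ¬ ∃ λ m → t ≤ m × IsLargest P m
largest-within P bound zero {t} B≤t+0 Pt none =
  none (t , ≤-refl , Pt , λ s Ps →
    ≤-trans (bound s Ps) (≤-trans B≤t+0 (≤-reflexive (+-identityʳ t))))
largest-within P {B} bound (suc k) {t} B≤t+1+k Pt none =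
  none (t , ≤-refl , Pt , λ s Ps → ≮⇒≥ λ t<s →
    largest-within P bound k (B≤s+k t<s) Ps λ (m , s≤m , m-largest) →
      none (m , ≤-trans (<⇒≤ t<s) s≤m , m-largest))
  where
  B≤s+k : ∀ {s} → t < s → B ≤ s + k
  B≤s+k {s} t<s = ≤-trans B≤t+1+k (subst (_≤ s + k) (sym (+-suc t k)) (+-monoˡ-≤ k t<s))

largest-above : (P : ℕ → Set) {B t : ℕ} → (∀ s → P s → s ≤ B) → P t →
  ¬ ¬ ∃ λ m → t ≤ m × IsLargest P m
largest-above P {B} {t} bound = largest-within P bound B (m≤n+m B t)

largest-largest-shift : {L : Set} (P Q : L → ℕ → Set) (c B : ℕ) →
  (∀ ℓ s → P ℓ s → Q ℓ (c + s)) → (∀ ℓ s → Q ℓ s → s ≤ B) →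
  ∀ mP mQ → IsLargest (λ m → ∃ λ ℓ → IsLargest (P ℓ) m) mP →
            IsLargest (λ m → ∃ λ ℓ → IsLargest (Q ℓ) m) mQ → c + mP ≤ mQ
largest-largest-shift P Q c B P⇒Q bound mP mQ ((ℓ , Pℓ , _) , _) (_ , mQ-max) =
  decidable-stable (c + mP ≤? mQ) λ c+mP≰mQ →
    largest-above (Q ℓ) (bound ℓ) (P⇒Q ℓ mP Pℓ) λ (m , c+mP≤m , m-largest) →
      c+mP≰mQ (≤-trans c+mP≤m (mQ-max m (ℓ , m-largest)))

lemma2p6 : ∀ {n ε} (H : Hypergraph n ε) (Δ a b r : ℕ) →
    IsMaxDegree H Δ → 1 ≤ Δ → b < Δ → r ≡ a * Δ + b →
    (∀ mb mr → IsMS H b mb → IsMS H r mr → a * ε + mb ≤ mr) ×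
    (∀ mb mr → IsCMS H b mb → IsCMS H r mr → a * ε + mb ≤ mr)
lemma2p6 {ε = zero}  H Δ a b r (_ , _ , refl) () _ _
lemma2p6 {ε = suc e} H Δ a b r (deg≤Δ , v , deg≡Δ) 1≤Δ _ refl =
    largest-largest-shift (λ ℓ → GoodMS H ℓ b) (λ ℓ → GoodMS H ℓ r) (a * suc e) (suc r * suc e)
      (λ ℓ _ → goodMS-+rounds H deg≤Δ ℓ a) (λ ℓ → goodMS⇒≤ H ℓ 1≤deg)
  , largest-largest-shift (λ ℓ → GoodCMS H ℓ b) (λ ℓ → GoodCMS H ℓ r) (a * suc e) (suc r * suc e)
      (λ ℓ _ → goodCMS-+rounds H deg≤Δ ℓ a) (λ ℓ → goodCMS⇒≤ H ℓ 1≤deg)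
  where
  1≤deg : 1 ≤ deg H v
  1≤deg = subst (1 ≤_) (sym deg≡Δ) 1≤Δ
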